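{- Let $\mathbf t:\mathcal D\to\mathcal T$ be a functor, $c:A\to B$ a morphism of $\mathcal T$ and $P\sqsubset A$, and suppose the pushforward $c_!P$ of $P$ along $c$ exists in $\mathbf t$. Then, as presheaves on $B^+$, (a) $(c_!P)^+\cong{}^{\perp}\big((c^-)^*P^-\big)$, and (b) $(c_!P)^+\cong{}^{\perp}\big(((c^+)_!P^+)^{\perp}\big)$.
   Context: Write $P\sqsubset A$ if $\mathbf t(P)=A$; composition is diagrammatic ($c;d$ = $c$ then $d$); a derivation $\alpha:P\Rightarrow_c Q$ is a morphism $\alpha:P\to Q$ of $\mathcal D$ with $\mathbf t(\alpha)=c$. A pushforward of $P\sqsubset A$ along $c:A\to B$ is a refinement $c_!P\sqsubset B$ with a derivation $r:P\Rightarrow_c c_!P$ such that for every $Q\sqsubset C$ and $d:B\to C$, $\beta\mapsto r;\beta$ is a bijection from derivations $c_!P\Rightarrow_d Q$ to derivations $P\Rightarrow_{c;d}Q$. $B^+$: objects $(P,c)$ with $P\sqsubset A$, $c:A\to B$; morphisms $(P_1,c_1)\to(P_2,c_2)$ derivations $\alpha:P_1\Rightarrow_e P_2$ with $c_1=e;c_2$. $c^+:A^+\to B^+$, $(P,d)\mapsto(P,d;c)$. $Q^+$ on $B^+$: $(P,c)\mapsto\{$derivations $P\Rightarrow_c Q\}$, acting by precomposition. The coslice of $B$ has objects $(d,R)$ with $d:B\to C$, $R\sqsubset C$ and morphisms $(d_1,R_1)\to(d_2,R_2)$ derivations $\gamma:R_1\Rightarrow_e R_2$ with $d_1;e=d_2$;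 $B^-$ is its opposite. $c^-:B^-\to A^-$ is induced by $(d,R)\mapsto(c;d,R)$. $P^-$ on $A^-$: $(d,R)\mapsto\{$derivations $P\Rightarrow_d R\}$, coslice morphisms acting by postcomposition. $J(\mathbf t)$: objects triples $(P,c,Q)$; morphisms $(P_1,c_1,Q_1)\to(P_2,c_2,Q_2)$ pairs $\beta:P_1\Rightarrow_e P_2$, $\gamma:Q_2\Rightarrow_{e'}Q_1$ with $c_1=e;c_2;e'$. $\mathrm{Der}$ on $J(\mathbf t)$: $(P,c,Q)\mapsto\{$derivations $P\Rightarrow_c Q\}$, $(\beta,\gamma)$ acting by $\alpha\mapsto\beta;\alpha;\gamma$. Bracket $\langle-,-\rangle_B:B^+\times B^-\to J(\mathbf t)$: $((P,c),(d,R))\mapsto(P,c;d,R)$, on morphisms $(\alpha,\gamma)\mapsto(\alpha,\gamma)$. For a presheaf $\varphi$ on $B^+$, $\varphi^\perp$ is the presheaf on $B^-$, $y\mapsto\mathrm{Nat}(\varphi,\mathrm{Der}(\langle-,y\rangle_B))$; for $\psi$ on $B^-$, ${}^\perp\psi$ is the presheaf on $B^+$, $x\mapsto\mathrm{Nat}(\psi,\mathrm{Der}(\langle x,-\rangle_B))$ (similarly over $A$). For a functor $F:\mathcal X\to\mathcal Y$ and presheaves $\varphi$ on $\mathcal X$, $\psi$ on $\mathcal Y$: $F^*\psi=\psi\circ F^{op}$, $F_!\varphi(y)=\int^{x}\mathcal Y(y,Fx)\times\varphi(x)$. $\cong$ is natural isomorphism. -}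

module Defs where

open import Level using (Level; _⊔_) renaming (suc to lsuc)
open import Data.Product using (Σ; _×_; _,_; proj₁; proj₂)
open import Relation.Binary.Core using (Rel)
open import Relation.Binary.Bundles using (Setoid)
open import Relation.Binary.Structures using (IsEquivalence)
open import Relation.Binary.PropositionalEquality using (_≡_; refl)
open import Function.Definitions using (Bijective)
import Relation.Binary.Construct.Closure.Equivalence as EqC
open import Relation.Binary.Construct.Closure.ReflexiveTransitive using (ε; _◅_)
open import Relation.Binary.Construct.Closure.Symmetric using (fwd)

record Category (ℓ : Level) : Set (lsuc ℓ) where
  infix 4 _≈_
  field
    Obj : Set ℓ
    Hom : Obj → Obj → Set ℓ
    _≈_ : ∀ {A B} → Rel (Hom A B) ℓ
    ≈-equiv : ∀ {A B} → IsEquivalence (_≈_ {A} {B})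
    id : ∀ {A} → Hom A A
    _⨾_ : ∀ {A B C} → Hom A B → Hom B C → Hom A C
    ⨾-resp : ∀ {A B C} {f f' : Hom A B} {g g' : Hom B C} →
             f ≈ f' → g ≈ g' → (f ⨾ g) ≈ (f' ⨾ g')
    idˡ : ∀ {A B} {f : Hom A B} → (id ⨾ f) ≈ f
    idʳ : ∀ {A B} {f : Hom A B} → (f ⨾ id) ≈ f
    assoc : ∀ {A B C E} {f : Hom A B} {g : Hom B C} {h : Hom C E} →
            ((f ⨾ g) ⨾ h) ≈ (f ⨾ (g ⨾ h))

  ≈-refl : ∀ {A B} {f : Hom A B} → f ≈ f
  ≈-refl = IsEquivalence.refl ≈-equiv

  ≈-sym : ∀ {A B} {f g : Hom A B} → f ≈ g → g ≈ f
  ≈-sym = IsEquivalence.sym ≈-equiv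

  ≈-trans : ∀ {A B} {f g h : Hom A B} → f ≈ g → g ≈ h → f ≈ h
  ≈-trans = IsEquivalence.trans ≈-equiv

module HomR {ℓ} (C : Category ℓ) where
  open Category C
  infix 1 begin_
  infixr 2 _≈⟨_⟩_ _≈˘⟨_⟩_
  infix 3 _∎
  begin_ : ∀ {A B} {f g : Hom A B} → f ≈ g → f ≈ g
  begin p = p
  _≈⟨_⟩_ : ∀ {A B} (f : Hom A B) {g h : Hom A B} → f ≈ g → g ≈ h → f ≈ h
  f ≈⟨ p ⟩ q = ≈-trans p q
  _≈˘⟨_⟩_ : ∀ {A B} (f : Hom A B) {g h : Hom A B} → g ≈ f → g ≈ h → f ≈ h
  f ≈˘⟨ p ⟩ q = ≈-trans (≈-sym p) q
  _∎ : ∀ {A B} (f : Hom A B) → f ≈ f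
  f ∎ = ≈-refl

module Rebracket {ℓ} (C : Category ℓ) where
  open Category C
  open HomR C

  assoc⁻ : ∀ {A B E F} {f : Hom A B} {g : Hom B E} {h : Hom E F} →
           (f ⨾ (g ⨾ h)) ≈ ((f ⨾ g) ⨾ h)
  assoc⁻ = ≈-sym assoc

  mid4 : ∀ {A B E F G} {a : Hom A B} {b : Hom B E} {c : Hom E F} {d : Hom F G} →
         ((a ⨾ b) ⨾ (c ⨾ d)) ≈ ((a ⨾ (b ⨾ c)) ⨾ d)
  mid4 {a = a} {b} {c} {d} = begin
    (a ⨾ b) ⨾ (c ⨾ d) ≈˘⟨ assoc ⟩
    ((a ⨾ b) ⨾ c) ⨾ d ≈⟨ ⨾-resp assoc ≈-refl ⟩
    (a ⨾ (b ⨾ c)) ⨾ d ∎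

  five : ∀ {A B E F G H} {a : Hom A B} {b : Hom B E} {c : Hom E F}
           {d : Hom F G} {e : Hom G H} →
         ((a ⨾ ((b ⨾ c) ⨾ d)) ⨾ e) ≈ (((a ⨾ b) ⨾ c) ⨾ (d ⨾ e))
  five {a = a} {b} {c} {d} {e} = begin
    (a ⨾ ((b ⨾ c) ⨾ d)) ⨾ e ≈˘⟨ ⨾-resp assoc ≈-refl ⟩
    ((a ⨾ (b ⨾ c)) ⨾ d) ⨾ e ≈⟨ assoc ⟩
    (a ⨾ (b ⨾ c)) ⨾ (d ⨾ e) ≈˘⟨ ⨾-resp assoc ≈-refl ⟩
    ((a ⨾ b) ⨾ c) ⨾ (d ⨾ e) ∎

record Functor {ℓ} (C E : Category ℓ) : Set ℓ where
  private
    module C = Category C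
    module E = Category E
  field
    F₀ : C.Obj → E.Obj
    F₁ : ∀ {A B} → C.Hom A B → E.Hom (F₀ A) (F₀ B)
    F-resp : ∀ {A B} {f g : C.Hom A B} → f C.≈ g → F₁ f E.≈ F₁ g
    F-id : ∀ {A} → F₁ (C.id {A}) E.≈ E.id
    F-⨾ : ∀ {A B K} {f : C.Hom A B} {g : C.Hom B K} →
          F₁ (f C.⨾ g) E.≈ (F₁ f E.⨾ F₁ g)

op : ∀ {ℓ} → Category ℓ → Category ℓ
op C = record
  { Obj = Obj
  ; Hom = λ A B → Hom B A
  ; _≈_ = _≈_
  ; ≈-equiv = ≈-equiv
  ; id = id
  ; _⨾_ = λ f g → g ⨾ f
  ; ⨾-resp = λ p q → ⨾-resp q p
  ; idˡ = idʳ
  ; idʳ = idˡ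
  ; assoc = ≈-sym assoc
  }
  where open Category C

opF : ∀ {ℓ} {C E : Category ℓ} → Functor C E → Functor (op C) (op E)
opF F = record
  { F₀ = F₀ ; F₁ = F₁ ; F-resp = F-resp ; F-id = F-id
  ; F-⨾ = F-⨾ }
  where open Functor F

_×C_ : ∀ {ℓ} → Category ℓ → Category ℓ → Category ℓ
X ×C Y = record
  { Obj = X.Obj × Y.Obj
  ; Hom = λ a b → X.Hom (proj₁ a) (proj₁ b) × Y.Hom (proj₂ a) (proj₂ b)
  ; _≈_ = λ f g → (proj₁ f X.≈ proj₁ g) × (proj₂ f Y.≈ proj₂ g)
  ; ≈-equiv = record
      { refl = X.≈-refl , Y.≈-refl
      ; sym = λ p → X.≈-sym (proj₁ p) , Y.≈-sym (proj₂ p)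
      ; trans = λ p q → X.≈-trans (proj₁ p) (proj₁ q) , Y.≈-trans (proj₂ p) (proj₂ q)
      }
  ; id = X.id , Y.id
  ; _⨾_ = λ f g → (proj₁ f X.⨾ proj₁ g) , (proj₂ f Y.⨾ proj₂ g)
  ; ⨾-resp = λ p q → X.⨾-resp (proj₁ p) (proj₁ q) , Y.⨾-resp (proj₂ p) (proj₂ q)
  ; idˡ = X.idˡ , Y.idˡ
  ; idʳ = X.idʳ , Y.idʳ
  ; assoc = X.assoc , Y.assoc
  }
  where
    module X = Category X
    module Y = Category Y

El : ∀ {ℓ} → Setoid ℓ ℓ → Set ℓ
El = Setoid.Carrier

infix 4 _∋_≈_
_∋_≈_ : ∀ {ℓ} (S : Setoid ℓ ℓ) → El S → El S → Set ℓ
S ∋ a ≈ b = Setoid._≈_ S a b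

record Presheaf {ℓ} (C : Category ℓ) : Set (lsuc ℓ) where
  open Category C
  field
    F₀ : Obj → Setoid ℓ ℓ
    F₁ : ∀ {A B} → Hom A B → El (F₀ B) → El (F₀ A)
    F₁-cong : ∀ {A B} (f : Hom A B) {a a' : El (F₀ B)} →
              F₀ B ∋ a ≈ a' → F₀ A ∋ F₁ f a ≈ F₁ f a'
    F₁-resp : ∀ {A B} {f g : Hom A B} → f ≈ g →
              ∀ (a : El (F₀ B)) → F₀ A ∋ F₁ f a ≈ F₁ g a
    F-id : ∀ {A} (a : El (F₀ A)) → F₀ A ∋ F₁ id a ≈ a
    F-⨾ : ∀ {A B K} {f : Hom A B} {g : Hom B K} (a : El (F₀ K)) →
          F₀ A ∋ F₁ (f ⨾ g) a ≈ F₁ f (F₁ g a)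

record NatT {ℓ} {C : Category ℓ} (φ ψ : Presheaf C) : Set ℓ where
  private
    module C = Category C
    module φ = Presheaf φ
    module ψ = Presheaf ψ
  field
    η : ∀ x → El (φ.F₀ x) → El (ψ.F₀ x)
    η-cong : ∀ x {a a' : El (φ.F₀ x)} → φ.F₀ x ∋ a ≈ a' → ψ.F₀ x ∋ η x a ≈ η x a'
    natural : ∀ {x y} (f : C.Hom x y) (a : El (φ.F₀ y)) →
              ψ.F₀ x ∋ η x (φ.F₁ f a) ≈ ψ.F₁ f (η y a)

Nat : ∀ {ℓ} {C : Category ℓ} (φ ψ : Presheaf C) → Setoid ℓ ℓ
Nat φ ψ = record
  { Carrier = NatT φ ψ
  ; _≈_ = λ σ τ → ∀ x a → ψ.F₀ x ∋ NatT.η σ x a ≈ NatT.η τ x a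
  ; isEquivalence = record
      { refl = λ x a → Setoid.refl (ψ.F₀ x)
      ; sym = λ p x a → Setoid.sym (ψ.F₀ x) (p x a)
      ; trans = λ p q x a → Setoid.trans (ψ.F₀ x) (p x a) (q x a)
      }
  }
  where module ψ = Presheaf ψ

infix 4 _≅_
record _≅_ {ℓ} {C : Category ℓ} (φ ψ : Presheaf C) : Set ℓ where
  private
    module φ = Presheaf φ
    module ψ = Presheaf ψ
  field
    to : NatT φ ψ
    from : NatT ψ φ
    from∘to : ∀ x a → φ.F₀ x ∋ NatT.η from x (NatT.η to x a) ≈ a
    to∘from : ∀ x b → ψ.F₀ x ∋ NatT.η to x (NatT.η from x b) ≈ b

restrict : ∀ {ℓ} {X Y : Category ℓ} → Functor X Y → Presheaf Y → Presheaf X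
restrict {X = X} {Y} F ψ = record
  { F₀ = λ x → ψ.F₀ (F.F₀ x)
  ; F₁ = λ f → ψ.F₁ (F.F₁ f)
  ; F₁-cong = λ f p → ψ.F₁-cong (F.F₁ f) p
  ; F₁-resp = λ p a → ψ.F₁-resp (F.F-resp p) a
  ; F-id = λ {x} a → Setoid.trans (ψ.F₀ (F.F₀ x)) (ψ.F₁-resp F.F-id a) (ψ.F-id a)
  ; F-⨾ = λ {A} a → Setoid.trans (ψ.F₀ (F.F₀ A)) (ψ.F₁-resp F.F-⨾ a) (ψ.F-⨾ a)
  }
  where
    module F = Functor F
    module ψ = Presheaf ψ

-- Left Kan extension F_! φ (y) = ∫^x Y(y, F x) × φ(x), the coend being
-- the quotient of Σ x. Y(y,Fx) × φ(x) by the equivalence relation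
-- generated by (x', f ⨾ F u, a) ~ (x, f, φ(u) a) for u : x → x'
-- (together with the given equalities of the components).

module LanDef {ℓ} {X Y : Category ℓ} (F : Functor X Y) (φ : Presheaf X) where
  private
    module X = Category X
    module Y = Category Y
    module F = Functor F
    module φ = Presheaf φ

  Rep : Y.Obj → Set ℓ
  Rep y = Σ X.Obj (λ x → Y.Hom y (F.F₀ x) × El (φ.F₀ x))

  data Step {y : Y.Obj} : Rep y → Rep y → Set ℓ where
    eqv : ∀ {x} {f f' : Y.Hom y (F.F₀ x)} {a a' : El (φ.F₀ x)} →
          f Y.≈ f' → φ.F₀ x ∋ a ≈ a' → Step (x , f , a) (x , f' , a')
    glue : ∀ {x x'} (u : X.Hom x x') (f : Y.Hom y (F.F₀ x)) (a : El (φ.F₀ x')) →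
           Step (x' , (f Y.⨾ F.F₁ u) , a) (x , f , φ.F₁ u a)

  LanSetoid : Y.Obj → Setoid ℓ ℓ
  LanSetoid y = EqC.setoid (Step {y})

  act : ∀ {y' y} → Y.Hom y' y → Rep y → Rep y'
  act h (x , f , a) = x , (h Y.⨾ f) , a

  actStep : ∀ {y' y} (h : Y.Hom y' y) {p q : Rep y} →
            Step p q → EqC.EqClosure Step (act h p) (act h q)
  actStep h (eqv p q) = fwd (eqv (Y.⨾-resp Y.≈-refl p) q) ◅ ε
  actStep {x} h (glue u f a) =
    fwd (eqv (Y.≈-sym Y.assoc) (Setoid.refl (φ.F₀ _))) ◅ fwd (glue u (h Y.⨾ f) a) ◅ ε

  Lan : Presheaf Y
  Lan = record
    { F₀ = LanSetoid
    ; F₁ = act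
    ; F₁-cong = λ {B = y} h → EqC.gfold (EqC.isEquivalence Step) (act h) (actStep h)
    ; F₁-resp = λ p a → fwd (eqv (Y.⨾-resp p Y.≈-refl) (Setoid.refl (φ.F₀ (proj₁ a)))) ◅ ε
    ; F-id = λ a → fwd (eqv Y.idˡ (Setoid.refl (φ.F₀ (proj₁ a)))) ◅ ε
    ; F-⨾ = λ a → fwd (eqv Y.assoc (Setoid.refl (φ.F₀ (proj₁ a)))) ◅ ε
    }

Lan : ∀ {ℓ} {X Y : Category ℓ} → Functor X Y → Presheaf X → Presheaf Y
Lan F φ = LanDef.Lan F φ

module Perp {ℓ} {X Y Z : Category ℓ} (G : Functor (X ×C Y) Z) (Dz : Presheaf Z) where
  private
    module X = Category X
    module Y = Category Y
    module Z = Category Z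
    module G = Functor G
    module Dz = Presheaf Dz
    module XY = Category (X ×C Y)

  fixʳ : Y.Obj → Functor X Z
  fixʳ y = record
    { F₀ = λ x → G.F₀ (x , y)
    ; F₁ = λ f → G.F₁ (f , Y.id)
    ; F-resp = λ p → G.F-resp (p , Y.≈-refl)
    ; F-id = G.F-id
    ; F-⨾ = Z.≈-trans (G.F-resp (X.≈-refl , Y.≈-sym Y.idˡ)) G.F-⨾
    }

  fixˡ : X.Obj → Functor Y Z
  fixˡ x = record
    { F₀ = λ y → G.F₀ (x , y)
    ; F₁ = λ g → G.F₁ (X.id , g)
    ; F-resp = λ p → G.F-resp (X.≈-refl , p)
    ; F-id = G.F-id
    ; F-⨾ = Z.≈-trans (G.F-resp (X.≈-sym X.idˡ , Y.≈-refl)) G.F-⨾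
    }

  interchange : ∀ {x x' y y'} (f : X.Hom x x') (g : Y.Hom y y') →
    (G.F₁ (f , Y.id) Z.⨾ G.F₁ (X.id , g)) Z.≈ (G.F₁ (X.id , g) Z.⨾ G.F₁ (f , Y.id))
  interchange f g = Z.≈-trans (Z.≈-sym G.F-⨾)
    (Z.≈-trans (G.F-resp (X.≈-trans X.idʳ (X.≈-sym X.idˡ) ,
                           Y.≈-trans Y.idˡ (Y.≈-sym Y.idʳ))) G.F-⨾)

  perpR : Presheaf X → Presheaf Y
  perpR φ = record
    { F₀ = λ y → Nat φ (restrict (fixʳ y) Dz)
    ; F₁ = λ {y'} {y} g σ → record
        { η = λ x a → Dz.F₁ (G.F₁ (X.id , g)) (NatT.η σ x a)
        ; η-cong = λ x p → Dz.F₁-cong _ (NatT.η-cong σ x p)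
        ; natural = λ {x} {x₁} f a →
            let S = Dz.F₀ (G.F₀ (x , y')) in
            Setoid.trans S (Dz.F₁-cong (G.F₁ (X.id , g)) (NatT.natural σ f a))
              (Setoid.trans S (Setoid.sym S (Dz.F-⨾ (NatT.η σ x₁ a)))
                (Setoid.trans S (Dz.F₁-resp (Z.≈-sym (interchange f g)) (NatT.η σ x₁ a))
                  (Dz.F-⨾ (NatT.η σ x₁ a))))
        }
    ; F₁-cong = λ g p x a → Dz.F₁-cong _ (p x a)
    ; F₁-resp = λ p σ x a → Dz.F₁-resp (G.F-resp (X.≈-refl , p)) (NatT.η σ x a)
    ; F-id = λ {y} σ x a → Setoid.trans (Dz.F₀ (G.F₀ (x , y)))
        (Dz.F₁-resp G.F-id (NatT.η σ x a)) (Dz.F-id (NatT.η σ x a))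
    ; F-⨾ = λ {y} σ x a → Setoid.trans (Dz.F₀ (G.F₀ (x , y)))
        (Dz.F₁-resp (Z.≈-trans (G.F-resp (X.≈-sym X.idˡ , Y.≈-refl)) G.F-⨾) (NatT.η σ x a))
        (Dz.F-⨾ (NatT.η σ x a))
    }
    where module φ = Presheaf φ

  perpL : Presheaf Y → Presheaf X
  perpL ψ = record
    { F₀ = λ x → Nat ψ (restrict (fixˡ x) Dz)
    ; F₁ = λ {x'} {x} f σ → record
        { η = λ y a → Dz.F₁ (G.F₁ (f , Y.id)) (NatT.η σ y a)
        ; η-cong = λ y p → Dz.F₁-cong _ (NatT.η-cong σ y p)
        ; natural = λ {y} {y₁} g a →
            let S = Dz.F₀ (G.F₀ (x' , y)) in
            Setoid.trans S (Dz.F₁-cong (G.F₁ (f , Y.id)) (NatT.natural σ g a))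
              (Setoid.trans S (Setoid.sym S (Dz.F-⨾ (NatT.η σ y₁ a)))
                (Setoid.trans S (Dz.F₁-resp (interchange f g) (NatT.η σ y₁ a))
                  (Dz.F-⨾ (NatT.η σ y₁ a))))
        }
    ; F₁-cong = λ f p y a → Dz.F₁-cong _ (p y a)
    ; F₁-resp = λ p σ y a → Dz.F₁-resp (G.F-resp (p , Y.≈-refl)) (NatT.η σ y a)
    ; F-id = λ {x} σ y a → Setoid.trans (Dz.F₀ (G.F₀ (x , y)))
        (Dz.F₁-resp G.F-id (NatT.η σ y a)) (Dz.F-id (NatT.η σ y a))
    ; F-⨾ = λ {x} σ y a → Setoid.trans (Dz.F₀ (G.F₀ (x , y)))
        (Dz.F₁-resp (Z.≈-trans (G.F-resp (X.≈-refl , Y.≈-sym Y.idˡ)) G.F-⨾) (NatT.η σ y a))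
        (Dz.F-⨾ (NatT.η σ y a))
    }
    where module ψ = Presheaf ψ

-- Refinement systems: a functor t : D → T.
-- "P ⊏ A" means t₀ P ≡ A.  A derivation α : P ⇒_c Q (for
-- c : t P → t Q) is a morphism α : P → Q of D with t(α) ≈ c.

module Refinement {ℓ} {D T : Category ℓ} (t : Functor D T) where
  private
    module D = Category D
    module T = Category T
    module t = Functor t
    module RT = Rebracket T
    module RD = Rebracket D

  t₀ = t.F₀
  t₁ = t.F₁

  Deriv : (P Q : D.Obj) → T.Hom (t₀ P) (t₀ Q) → Set ℓ
  Deriv P Q c = Σ (D.Hom P Q) (λ α → t₁ α T.≈ c)

  _≈ᵈ_ : ∀ {P Q c} → Rel (Deriv P Q c) ℓ
  α ≈ᵈ β = proj₁ α D.≈ proj₁ β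

  DerivSetoid : (P Q : D.Obj) → T.Hom (t₀ P) (t₀ Q) → Setoid ℓ ℓ
  DerivSetoid P Q c = record
    { Carrier = Deriv P Q c
    ; _≈_ = _≈ᵈ_
    ; isEquivalence = record { refl = D.≈-refl ; sym = D.≈-sym ; trans = D.≈-trans }
    }

  _⨾ᵈ_ : ∀ {P Q R} {c : T.Hom (t₀ P) (t₀ Q)} {d : T.Hom (t₀ Q) (t₀ R)} →
         Deriv P Q c → Deriv Q R d → Deriv P R (c T.⨾ d)
  (α , p) ⨾ᵈ (β , q) = (α D.⨾ β) , T.≈-trans t.F-⨾ (T.⨾-resp p q)

  -- B^+ : objects (P , c) with c : t P → B (i.e. P ⊏ A := t P, c : A → B),
  -- morphisms (P₁,c₁) → (P₂,c₂): α : P₁ → P₂ in D with c₁ ≈ t(α) ⨾ c₂.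

  Plus : T.Obj → Category ℓ
  Plus B = record
    { Obj = Σ D.Obj (λ P → T.Hom (t₀ P) B)
    ; Hom = λ x y → Σ (D.Hom (proj₁ x) (proj₁ y))
                      (λ α → proj₂ x T.≈ (t₁ α T.⨾ proj₂ y))
    ; _≈_ = λ f g → proj₁ f D.≈ proj₁ g
    ; ≈-equiv = record { refl = D.≈-refl ; sym = D.≈-sym ; trans = D.≈-trans }
    ; id = D.id , T.≈-sym (T.≈-trans (T.⨾-resp t.F-id T.≈-refl) T.idˡ)
    ; _⨾_ = λ f g → (proj₁ f D.⨾ proj₁ g) ,
        T.≈-trans (proj₂ f) (T.≈-trans (T.⨾-resp T.≈-refl (proj₂ g))
          (T.≈-trans RT.assoc⁻ (T.⨾-resp (T.≈-sym t.F-⨾) T.≈-refl)))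
    ; ⨾-resp = D.⨾-resp
    ; idˡ = D.idˡ
    ; idʳ = D.idʳ
    ; assoc = D.assoc
    }

  Coslice : T.Obj → Category ℓ
  Coslice B = record
    { Obj = Σ D.Obj (λ R → T.Hom B (t₀ R))
    ; Hom = λ x y → Σ (D.Hom (proj₁ x) (proj₁ y))
                      (λ γ → (proj₂ x T.⨾ t₁ γ) T.≈ proj₂ y)
    ; _≈_ = λ f g → proj₁ f D.≈ proj₁ g
    ; ≈-equiv = record { refl = D.≈-refl ; sym = D.≈-sym ; trans = D.≈-trans }
    ; id = D.id , T.≈-trans (T.⨾-resp T.≈-refl t.F-id) T.idʳ
    ; _⨾_ = λ f g → (proj₁ f D.⨾ proj₁ g) ,
        T.≈-trans (T.⨾-resp T.≈-refl t.F-⨾)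
          (T.≈-trans RT.assoc⁻ (T.≈-trans (T.⨾-resp (proj₂ f) T.≈-refl) (proj₂ g)))
    ; ⨾-resp = D.⨾-resp
    ; idˡ = D.idˡ
    ; idʳ = D.idʳ
    ; assoc = D.assoc
    }

  Minus : T.Obj → Category ℓ
  Minus B = op (Coslice B)

  cplus : ∀ {A B} → T.Hom A B → Functor (Plus A) (Plus B)
  cplus c = record
    { F₀ = λ x → proj₁ x , (proj₂ x T.⨾ c)
    ; F₁ = λ f → proj₁ f , T.≈-trans (T.⨾-resp (proj₂ f) T.≈-refl) T.assoc
    ; F-resp = λ p → p
    ; F-id = D.≈-refl
    ; F-⨾ = D.≈-refl
    }

  ccoslice : ∀ {A B} → T.Hom A B → Functor (Coslice B) (Coslice A)
  ccoslice c = record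
    { F₀ = λ y → proj₁ y , (c T.⨾ proj₂ y)
    ; F₁ = λ g → proj₁ g , T.≈-trans T.assoc (T.⨾-resp T.≈-refl (proj₂ g))
    ; F-resp = λ p → p
    ; F-id = D.≈-refl
    ; F-⨾ = D.≈-refl
    }

  cminus : ∀ {A B} → T.Hom A B → Functor (Minus B) (Minus A)
  cminus c = opF (ccoslice c)

  J : Category ℓ
  J = record
    { Obj = Σ D.Obj (λ P → Σ D.Obj (λ Q → T.Hom (t₀ P) (t₀ Q)))
    ; Hom = λ x y → Σ (D.Hom (proj₁ x) (proj₁ y) × D.Hom (proj₁ (proj₂ y)) (proj₁ (proj₂ x)))
                      (λ βγ → proj₂ (proj₂ x) T.≈
                                ((t₁ (proj₁ βγ) T.⨾ proj₂ (proj₂ y)) T.⨾ t₁ (proj₂ βγ)))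
    ; _≈_ = λ f g → (proj₁ (proj₁ f) D.≈ proj₁ (proj₁ g)) × (proj₂ (proj₁ f) D.≈ proj₂ (proj₁ g))
    ; ≈-equiv = record
        { refl = D.≈-refl , D.≈-refl
        ; sym = λ p → D.≈-sym (proj₁ p) , D.≈-sym (proj₂ p)
        ; trans = λ p q → D.≈-trans (proj₁ p) (proj₁ q) , D.≈-trans (proj₂ p) (proj₂ q)
        }
    ; id = (D.id , D.id) ,
        T.≈-sym (T.≈-trans (T.⨾-resp (T.≈-trans (T.⨾-resp t.F-id T.≈-refl) T.idˡ) t.F-id) T.idʳ)
    ; _⨾_ = λ f g →
        ((proj₁ (proj₁ f) D.⨾ proj₁ (proj₁ g)) , (proj₂ (proj₁ g) D.⨾ proj₂ (proj₁ f))) ,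
        T.≈-trans (proj₂ f)
          (T.≈-trans (T.⨾-resp (T.⨾-resp T.≈-refl (proj₂ g)) T.≈-refl)
            (T.≈-trans RT.five
              (T.⨾-resp (T.⨾-resp (T.≈-sym t.F-⨾) T.≈-refl) (T.≈-sym t.F-⨾))))
    ; ⨾-resp = λ p q → D.⨾-resp (proj₁ p) (proj₁ q) , D.⨾-resp (proj₂ q) (proj₂ p)
    ; idˡ = D.idˡ , D.idʳ
    ; idʳ = D.idʳ , D.idˡ
    ; assoc = D.assoc , D.≈-sym D.assoc
    }

  Der : Presheaf J
  Der = record
    { F₀ = λ x → DerivSetoid (proj₁ x) (proj₁ (proj₂ x)) (proj₂ (proj₂ x))
    ; F₁ = λ f α → ((proj₁ (proj₁ f) D.⨾ proj₁ α) D.⨾ proj₂ (proj₁ f)) ,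
        T.≈-trans t.F-⨾ (T.≈-trans (T.⨾-resp (T.≈-trans t.F-⨾ (T.⨾-resp T.≈-refl (proj₂ α))) T.≈-refl)
          (T.≈-sym (proj₂ f)))
    ; F₁-cong = λ f p → D.⨾-resp (D.⨾-resp D.≈-refl p) D.≈-refl
    ; F₁-resp = λ p a → D.⨾-resp (D.⨾-resp (proj₁ p) D.≈-refl) (proj₂ p)
    ; F-id = λ a → D.≈-trans D.idʳ D.idˡ
    ; F-⨾ = λ a → D.≈-sym RD.five
    }

  bracket : (B : T.Obj) → Functor (Plus B ×C Minus B) J
  bracket B = record
    { F₀ = λ xy → proj₁ (proj₁ xy) , proj₁ (proj₂ xy) , (proj₂ (proj₁ xy) T.⨾ proj₂ (proj₂ xy))
    ; F₁ = λ fg → (proj₁ (proj₁ fg) , proj₁ (proj₂ fg)) ,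
        T.≈-trans (T.⨾-resp (proj₂ (proj₁ fg)) (T.≈-sym (proj₂ (proj₂ fg)))) RT.mid4
    ; F-resp = λ p → p
    ; F-id = D.≈-refl , D.≈-refl
    ; F-⨾ = D.≈-refl , D.≈-refl
    }

  plusBase : (Q : D.Obj) → Presheaf (Plus (t₀ Q))
  plusBase Q = record
    { F₀ = λ x → DerivSetoid (proj₁ x) Q (proj₂ x)
    ; F₁ = λ f β → (proj₁ f D.⨾ proj₁ β) ,
        T.≈-trans t.F-⨾ (T.≈-trans (T.⨾-resp T.≈-refl (proj₂ β)) (T.≈-sym (proj₂ f)))
    ; F₁-cong = λ f p → D.⨾-resp D.≈-refl p
    ; F₁-resp = λ p a → D.⨾-resp p D.≈-refl
    ; F-id = λ a → D.idˡ
    ; F-⨾ = λ a → D.assoc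
    }

  minusBase : (P : D.Obj) → Presheaf (Minus (t₀ P))
  minusBase P = record
    { F₀ = λ y → DerivSetoid P (proj₁ y) (proj₂ y)
    ; F₁ = λ g α → (proj₁ α D.⨾ proj₁ g) ,
        T.≈-trans t.F-⨾ (T.≈-trans (T.⨾-resp (proj₂ α) T.≈-refl) (proj₂ g))
    ; F₁-cong = λ g p → D.⨾-resp p D.≈-refl
    ; F₁-resp = λ p a → D.⨾-resp D.≈-refl p
    ; F-id = λ a → D.idʳ
    ; F-⨾ = λ a → D.≈-sym D.assoc
    }

  plusPsh : ∀ {B} (Q : D.Obj) → t₀ Q ≡ B → Presheaf (Plus B)
  plusPsh Q refl = plusBase Q

  minusPsh : ∀ {A} (P : D.Obj) → t₀ P ≡ A → Presheaf (Minus A)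
  minusPsh P refl = minusBase P

  _^⊥ : ∀ {B} → Presheaf (Plus B) → Presheaf (Minus B)
  _^⊥ {B} φ = Perp.perpR (bracket B) Der φ

  ⊥^_ : ∀ {B} → Presheaf (Minus B) → Presheaf (Plus B)
  ⊥^_ {B} ψ = Perp.perpL (bracket B) Der ψ

  record IsPushforward (P Q : D.Obj) (c : T.Hom (t₀ P) (t₀ Q)) : Set ℓ where
    field
      r : Deriv P Q c
      universal : ∀ (R : D.Obj) (d : T.Hom (t₀ Q) (t₀ R)) →
        Bijective (_≈ᵈ_ {Q} {R} {d}) (_≈ᵈ_ {P} {R} {c T.⨾ d}) (λ β → r ⨾ᵈ β)

  castHom : ∀ {P Q : D.Obj} {A B : T.Obj} → t₀ P ≡ A → t₀ Q ≡ B →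
            T.Hom A B → T.Hom (t₀ P) (t₀ Q)
  castHom refl refl c = c

  record Pushforward {A B : T.Obj} (P : D.Obj) (pA : t₀ P ≡ A) (c : T.Hom A B) : Set ℓ where
    field
      obj : D.Obj
      over : t₀ obj ≡ B
      isPushforward : IsPushforward P obj (castHom pA over c)

-- Write Q for c_!P. The presheaves Q⁺ on B⁺ and P⁺ on A⁺, P⁻ on A⁻ and Q⁻ on B⁻ are
-- representable, at (Q , id) and (P , id), so the Yoneda lemma gives ⊥(Q⁻) ≅ Q⁺ and
-- (P⁺)⊥ ≅ P⁻. The universal property of r : P ⇒_c Q says exactly that (c⁻)*P⁻ ≅ Q⁻,
-- which yields (a). For (b), the left Kan extension (c⁺)_! is left adjoint to
-- restriction along c⁺, and since ⟨c⁺ x , y⟩_B and ⟨x , c⁻ y⟩_A agree up to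
-- reassociation this becomes ((c⁺)_! φ)⊥ ≅ (c⁻)*(φ⊥); for φ = P⁺ the presheaf
-- orthogonalised in (b) is therefore isomorphic to (c⁻)*P⁻ as well.

module Submission where

open import Defs
open import Level using (Level)
open import Data.Product using (_×_; _,_; proj₁; proj₂)
open import Relation.Binary.PropositionalEquality using (_≡_; refl)
open import Relation.Binary.Bundles using (Setoid)
import Relation.Binary.Construct.Closure.Equivalence as EqC
open import Relation.Binary.Construct.Closure.ReflexiveTransitive using (ε; _◅_)
open import Relation.Binary.Construct.Closure.Symmetric using (fwd; bwd)

module _ {ℓ} {C : Category ℓ} where

  infixr 9 _⨾ⁿ_
  _⨾ⁿ_ : {φ ψ χ : Presheaf C} → NatT φ ψ → NatT ψ χ → NatT φ χ
  _⨾ⁿ_ {χ = χ} σ τ = record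
    { η = λ x a → NatT.η τ x (NatT.η σ x a)
    ; η-cong = λ x p → NatT.η-cong τ x (NatT.η-cong σ x p)
    ; natural = λ f a → Setoid.trans (Presheaf.F₀ χ _)
        (NatT.η-cong τ _ (NatT.natural σ f a)) (NatT.natural τ f _)
    }

  ≅-trans : {φ ψ χ : Presheaf C} → φ ≅ ψ → ψ ≅ χ → φ ≅ χ
  ≅-trans {φ} {ψ} {χ} i j = record
    { to = to i ⨾ⁿ to j
    ; from = from j ⨾ⁿ from i
    ; from∘to = λ x a → Setoid.trans (Presheaf.F₀ φ x)
        (NatT.η-cong (from i) x (from∘to j x _)) (from∘to i x a)
    ; to∘from = λ x a → Setoid.trans (Presheaf.F₀ χ x)
        (NatT.η-cong (to j) x (to∘from i x _)) (to∘from j x a)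
    }
    where open _≅_

restrict-resp-≅ : ∀ {ℓ} {X Y : Category ℓ} (F : Functor X Y) {φ ψ : Presheaf Y} →
                  φ ≅ ψ → restrict F φ ≅ restrict F ψ
restrict-resp-≅ F i = record
  { to = restrictNat (to i)
  ; from = restrictNat (from i)
  ; from∘to = λ x → from∘to i (F₀ x)
  ; to∘from = λ x → to∘from i (F₀ x)
  }
  where
    open _≅_
    open Functor F
    restrictNat : ∀ {φ ψ} → NatT φ ψ → NatT (restrict F φ) (restrict F ψ)
    restrictNat σ = record
      { η = λ x → NatT.η σ (F₀ x)
      ; η-cong = λ x → NatT.η-cong σ (F₀ x)
      ; natural = λ f → NatT.natural σ (F₁ f)
      }

module PerpProperties {ℓ} {X Y Z : Category ℓ} (G : Functor (X ×C Y) Z) (Dz : Presheaf Z) where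
  open Perp G Dz

  perpL-map : {ψ₁ ψ₂ : Presheaf Y} → NatT ψ₁ ψ₂ → NatT (perpL ψ₂) (perpL ψ₁)
  perpL-map m = record
    { η = λ x σ → m ⨾ⁿ σ
    ; η-cong = λ x p y a → p y _
    ; natural = λ f σ y a → Setoid.refl (Presheaf.F₀ Dz _)
    }

  perpL-resp-≅ : {ψ₁ ψ₂ : Presheaf Y} → ψ₁ ≅ ψ₂ → perpL ψ₂ ≅ perpL ψ₁
  perpL-resp-≅ i = record
    { to = perpL-map (_≅_.to i)
    ; from = perpL-map (_≅_.from i)
    ; from∘to = λ x σ y a → NatT.η-cong σ y (_≅_.to∘from i y a)
    ; to∘from = λ x σ y a → NatT.η-cong σ y (_≅_.from∘to i y a)
    }

module RefinementProperties {ℓ} {D T : Category ℓ} (t : Functor D T) where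
  open Refinement t
  private
    module D = Category D
    module T = Category T
    module t = Functor t
  open HomR D

  cast : ∀ {P Q} {e e' : T.Hom (t₀ P) (t₀ Q)} → e T.≈ e' → Deriv P Q e → Deriv P Q e'
  cast p (α , q) = α , T.≈-trans q p

  ⊥^-resp-≅ : ∀ {B} {ψ₁ ψ₂ : Presheaf (Minus B)} → ψ₁ ≅ ψ₂ → ⊥^ ψ₂ ≅ ⊥^ ψ₁
  ⊥^-resp-≅ {B} = PerpProperties.perpL-resp-≅ (bracket B) Der

  private
    assoc-idʳ : ∀ {P Q R S} {f : D.Hom P Q} {g : D.Hom Q R} {h : D.Hom R S} →
                ((f D.⨾ g) D.⨾ h) D.≈ ((f D.⨾ (g D.⨾ h)) D.⨾ D.id)
    assoc-idʳ = D.≈-trans D.assoc (D.≈-sym D.idʳ)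

    assoc-idˡ : ∀ {P Q R S} {f : D.Hom P Q} {g : D.Hom Q R} {h : D.Hom R S} →
                (f D.⨾ (g D.⨾ h)) D.≈ ((D.id D.⨾ (f D.⨾ g)) D.⨾ h)
    assoc-idˡ = D.≈-trans (D.≈-sym D.assoc) (D.⨾-resp (D.≈-sym D.idˡ) D.≈-refl)

    idᵈ : ∀ {P} → Deriv P P T.id
    idᵈ = D.id , t.F-id

  plus≅⊥minus : (Q : D.Obj) → plusBase Q ≅ ⊥^ minusBase Q
  plus≅⊥minus Q = record
    { to = record
        { η = λ x β → record
            { η = λ y α → β ⨾ᵈ α
            ; η-cong = λ y p → D.⨾-resp D.≈-refl p
            ; natural = λ g α → assoc-idˡ
            }
        ; η-cong = λ x p y α → D.⨾-resp p D.≈-refl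
        ; natural = λ f β y α → assoc-idʳ
        }
    ; from = record
        { η = λ x σ → cast T.idʳ (NatT.η σ yQ idᵈ)
        ; η-cong = λ x p → p yQ idᵈ
        ; natural = λ f σ → D.idʳ
        }
    ; from∘to = λ x β → D.idʳ
    ; to∘from = determined-at-id
    }
    where
      yQ : Category.Obj (Minus (t₀ Q))
      yQ = Q , T.id

      determined-at-id : ∀ x (σ : El (Presheaf.F₀ (⊥^ minusBase Q) x)) y α →
        (proj₁ (NatT.η σ yQ idᵈ) D.⨾ proj₁ α) D.≈ proj₁ (NatT.η σ y α)
      determined-at-id x σ y α = begin
        σ₀ D.⨾ proj₁ α                     ≈˘⟨ D.⨾-resp D.idˡ D.≈-refl ⟩
        (D.id D.⨾ σ₀) D.⨾ proj₁ α          ≈˘⟨ NatT.natural σ α⁻ idᵈ ⟩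
        proj₁ (NatT.η σ y (Presheaf.F₁ (minusBase Q) α⁻ idᵈ)) ≈⟨ NatT.η-cong σ y D.idˡ ⟩
        proj₁ (NatT.η σ y α)               ∎
        where
          σ₀ : D.Hom (proj₁ x) Q
          σ₀ = proj₁ (NatT.η σ yQ idᵈ)
          α⁻ : Category.Hom (Minus (t₀ Q)) y yQ
          α⁻ = proj₁ α , T.≈-trans T.idˡ (proj₂ α)

  plus⊥≅minus : (P : D.Obj) → plusBase P ^⊥ ≅ minusBase P
  plus⊥≅minus P = record
    { to = record
        { η = λ y σ → cast T.idˡ (NatT.η σ xP idᵈ)
        ; η-cong = λ y p → p xP idᵈ
        ; natural = λ g σ → D.⨾-resp D.idˡ D.≈-refl
        }
    ; from = record
        { η = λ y α → record
            { η = λ x β → β ⨾ᵈ α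
            ; η-cong = λ x p → D.⨾-resp p D.≈-refl
            ; natural = λ f β → assoc-idʳ
            }
        ; η-cong = λ y p x β → D.⨾-resp D.≈-refl p
        ; natural = λ g α x β → assoc-idˡ
        }
    ; from∘to = determined-at-id
    ; to∘from = λ y α → D.idˡ
    }
    where
      xP : Category.Obj (Plus (t₀ P))
      xP = P , T.id

      determined-at-id : ∀ y (σ : El (Presheaf.F₀ (plusBase P ^⊥) y)) x β →
        (proj₁ β D.⨾ proj₁ (NatT.η σ xP idᵈ)) D.≈ proj₁ (NatT.η σ x β)
      determined-at-id y σ x β = begin
        proj₁ β D.⨾ σ₀                     ≈˘⟨ D.idʳ ⟩
        (proj₁ β D.⨾ σ₀) D.⨾ D.id          ≈˘⟨ NatT.natural σ β⁺ idᵈ ⟩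
        proj₁ (NatT.η σ x (Presheaf.F₁ (plusBase P) β⁺ idᵈ)) ≈⟨ NatT.η-cong σ x D.idʳ ⟩
        proj₁ (NatT.η σ x β)               ∎
        where
          σ₀ : D.Hom P (proj₁ y)
          σ₀ = proj₁ (NatT.η σ xP idᵈ)
          β⁺ : Category.Hom (Plus (t₀ P)) x xP
          β⁺ = proj₁ β , T.≈-sym (T.≈-trans T.idʳ (proj₂ β))

  pushforward-minus≅ : ∀ {P Q c} → IsPushforward P Q c →
                       restrict (cminus c) (minusBase P) ≅ minusBase Q
  pushforward-minus≅ {P} {Q} {c} push = record
    { to = record
        { η = factor
        ; η-cong = λ y {α} {α'} p → r⨾-injective y (factor y α) (factor y α') (begin
            proj₁ (r ⨾ᵈ factor y α)  ≈⟨ r⨾factor y α ⟩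
            proj₁ α                  ≈⟨ p ⟩
            proj₁ α'                 ≈˘⟨ r⨾factor y α' ⟩
            proj₁ (r ⨾ᵈ factor y α') ∎)
        ; natural = factor-natural
        }
    ; from = record
        { η = λ y β → r ⨾ᵈ β
        ; η-cong = λ y p → D.⨾-resp D.≈-refl p
        ; natural = λ g β → D.≈-sym D.assoc
        }
    ; from∘to = r⨾factor
    ; to∘from = λ y β → r⨾-injective y (factor y (r ⨾ᵈ β)) β (r⨾factor y (r ⨾ᵈ β))
    }
    where
      open IsPushforward push

      factor : ∀ y → Deriv P (proj₁ y) (c T.⨾ proj₂ y) → Deriv Q (proj₁ y) (proj₂ y)
      factor (R , d) α = proj₁ (proj₂ (universal R d) α)

      r⨾factor : ∀ y (α : Deriv P (proj₁ y) (c T.⨾ proj₂ y)) →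
                 proj₁ (r ⨾ᵈ factor y α) D.≈ proj₁ α
      r⨾factor (R , d) α = proj₂ (proj₂ (universal R d) α) {factor (R , d) α} D.≈-refl

      r⨾-injective : ∀ y (β β' : Deriv Q (proj₁ y) (proj₂ y)) →
                     proj₁ (r ⨾ᵈ β) D.≈ proj₁ (r ⨾ᵈ β') → proj₁ β D.≈ proj₁ β'
      r⨾-injective (R , d) β β' = proj₁ (universal R d) {β} {β'}

      factor-natural : ∀ {y y'} (g : Category.Hom (Minus (t₀ Q)) y y') α →
        proj₁ (factor y (Presheaf.F₁ (minusBase P) (Functor.F₁ (cminus c) g) α))
          D.≈ proj₁ (Presheaf.F₁ (minusBase Q) g (factor y' α))
      factor-natural {y} {y'} g α = r⨾-injective y (factor y αg) βg (begin
        proj₁ r D.⨾ proj₁ (factor y αg)               ≈⟨ r⨾factor y αg ⟩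
        proj₁ α D.⨾ proj₁ g                           ≈˘⟨ D.⨾-resp (r⨾factor y' α) D.≈-refl ⟩
        (proj₁ r D.⨾ proj₁ (factor y' α)) D.⨾ proj₁ g ≈⟨ D.assoc ⟩
        proj₁ r D.⨾ (proj₁ (factor y' α) D.⨾ proj₁ g) ∎)
        where
          αg : Deriv P (proj₁ y) (c T.⨾ proj₂ y)
          αg = Presheaf.F₁ (minusBase P) (Functor.F₁ (cminus c) g) α
          βg : Deriv Q (proj₁ y) (proj₂ y)
          βg = Presheaf.F₁ (minusBase Q) g (factor y' α)

  module _ {A B : T.Obj} (c : T.Hom A B) (φ : Presheaf (Plus A)) where
    private
      module φ = Presheaf φ
      module PB = Category (Plus B)
      module L = LanDef (cplus c) φ

      c⁺ : Category.Obj (Plus A) → PB.Obj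
      c⁺ = Functor.F₀ (cplus c)

      unitRep : ∀ x → El (φ.F₀ x) → L.Rep (c⁺ x)
      unitRep x a = x , PB.id , a

    Lan⊥⇒restrict⊥ : NatT (Lan (cplus c) φ ^⊥) (restrict (cminus c) (φ ^⊥))
    Lan⊥⇒restrict⊥ = record
      { η = λ y σ → record
          { η = λ x a → cast T.assoc (NatT.η σ (c⁺ x) (unitRep x a))
          ; η-cong = λ x p → NatT.η-cong σ (c⁺ x) (EqC.return (L.eqv D.≈-refl p))
          ; natural = λ f a → D.≈-trans (NatT.η-cong σ _ (unitRep-glue f a))
                                         (NatT.natural σ (Functor.F₁ (cplus c) f) (unitRep _ a))
          }
      ; η-cong = λ y p x a → p (c⁺ x) (unitRep x a)
      ; natural = λ g σ x a → D.≈-refl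
      }
      where
        unitRep-glue : ∀ {x x'} (f : Category.Hom (Plus A) x x') (a : El (φ.F₀ x')) →
          L.LanSetoid (c⁺ x) ∋ unitRep x (φ.F₁ f a)
                             ≈ L.act (Functor.F₁ (cplus c) f) (unitRep x' a)
        unitRep-glue {x' = x'} f a =
          bwd (L.glue f PB.id a) ◅
          fwd (L.eqv (D.≈-trans D.idˡ (D.≈-sym D.idʳ)) (Setoid.refl (φ.F₀ x'))) ◅ ε

    private
      extend : ∀ {z x R e} → PB.Hom z (c⁺ x) →
               Deriv (proj₁ x) R (proj₂ x T.⨾ (c T.⨾ e)) → Deriv (proj₁ z) R (proj₂ z T.⨾ e)
      extend (f , p) (α , q) = f D.⨾ α ,
        T.≈-trans t.F-⨾ (T.≈-trans (T.⨾-resp T.≈-refl (T.≈-trans q (T.≈-sym T.assoc)))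
          (T.≈-trans (T.≈-sym T.assoc) (T.⨾-resp (T.≈-sym p) T.≈-refl)))

      induced : ∀ {y z} → El (Presheaf.F₀ (restrict (cminus c) (φ ^⊥)) y) →
                L.Rep z → Deriv (proj₁ z) (proj₁ y) (proj₂ z T.⨾ proj₂ y)
      induced τ (x , f , a) = extend f (NatT.η τ x a)

      induced-resp-Step : ∀ {y z} (τ : El (Presheaf.F₀ (restrict (cminus c) (φ ^⊥)) y))
        {p q : L.Rep z} → L.Step p q → proj₁ (induced τ p) D.≈ proj₁ (induced τ q)
      induced-resp-Step τ (L.eqv pf pa) = D.⨾-resp pf (NatT.η-cong τ _ pa)
      induced-resp-Step {y} τ (L.glue u f a) = begin
        (proj₁ f D.⨾ proj₁ u) D.⨾ τ'              ≈⟨ D.assoc ⟩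
        proj₁ f D.⨾ (proj₁ u D.⨾ τ')              ≈˘⟨ D.⨾-resp D.≈-refl D.idʳ ⟩
        proj₁ f D.⨾ ((proj₁ u D.⨾ τ') D.⨾ D.id)   ≈˘⟨ D.⨾-resp D.≈-refl (NatT.natural τ u a) ⟩
        proj₁ f D.⨾ proj₁ (NatT.η τ _ (φ.F₁ u a)) ∎
        where
          τ' : D.Hom _ (proj₁ y)
          τ' = proj₁ (NatT.η τ _ a)

    restrict⊥⇒Lan⊥ : NatT (restrict (cminus c) (φ ^⊥)) (Lan (cplus c) φ ^⊥)
    restrict⊥⇒Lan⊥ = record
      { η = λ y τ → record
          { η = λ z → induced τ
          ; η-cong = λ z → EqC.gfold (Setoid.isEquivalence (DerivSetoid _ _ _))
                                     (induced τ) (induced-resp-Step τ)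
          ; natural = λ h rep → assoc-idʳ
          }
      ; η-cong = λ y p z rep → D.⨾-resp D.≈-refl (p (proj₁ rep) (proj₂ (proj₂ rep)))
      ; natural = λ g τ z rep → D.≈-trans (D.⨾-resp D.≈-refl (D.⨾-resp D.idˡ D.≈-refl)) assoc-idˡ
      }

    Lan-cplus⊥≅ : Lan (cplus c) φ ^⊥ ≅ restrict (cminus c) (φ ^⊥)
    Lan-cplus⊥≅ = record
      { to = Lan⊥⇒restrict⊥
      ; from = restrict⊥⇒Lan⊥
      ; from∘to = determined-at-unit
      ; to∘from = λ y τ x a → D.idˡ
      }
      where
        determined-at-unit : ∀ y (σ : El (Presheaf.F₀ (Lan (cplus c) φ ^⊥) y)) z (rep : L.Rep z) →
          proj₁ (induced (NatT.η Lan⊥⇒restrict⊥ y σ) rep) D.≈ proj₁ (NatT.η σ z rep)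
        determined-at-unit y σ z (x , f , a) = begin
          proj₁ f D.⨾ σ₀                     ≈˘⟨ D.idʳ ⟩
          (proj₁ f D.⨾ σ₀) D.⨾ D.id          ≈˘⟨ NatT.natural σ f (unitRep x a) ⟩
          proj₁ (NatT.η σ z (L.act f (unitRep x a)))
            ≈⟨ NatT.η-cong σ z (EqC.return (L.eqv D.idʳ (Setoid.refl (φ.F₀ x)))) ⟩
          proj₁ (NatT.η σ z (x , f , a))    ∎
          where
            σ₀ : D.Hom (proj₁ x) (proj₁ y)
            σ₀ = proj₁ (NatT.η σ (c⁺ x) (unitRep x a))

proposition4p13 : ∀ {ℓ : Level} {D T : Category ℓ} (t : Functor D T)
                    {A B : Category.Obj T} (c : Category.Hom T A B)
                    (P : Category.Obj D) (pA : Functor.F₀ t P ≡ A)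
                    (pf : Refinement.Pushforward t P pA c) →
                    let open Refinement t
                        cP = Pushforward.obj pf
                        pB = Pushforward.over pf
                    in (plusPsh cP pB ≅ ⊥^ restrict (cminus c) (minusPsh P pA))
                       × (plusPsh cP pB ≅ ⊥^ (Lan (cplus c) (plusPsh P pA) ^⊥))
proposition4p13 t c P refl record { obj = Q ; over = refl ; isPushforward = push } =
  plus≅⊥restrict , ≅-trans plus≅⊥restrict (⊥^-resp-≅ Lan⊥≅restrict)
  where
    open Refinement t
    open RefinementProperties t

    plus≅⊥restrict : plusBase Q ≅ ⊥^ restrict (cminus c) (minusBase P)
    plus≅⊥restrict = ≅-trans (plus≅⊥minus Q) (⊥^-resp-≅ (pushforward-minus≅ push))

    Lan⊥≅restrict : Lan (cplus c) (plusBase P) ^⊥ ≅ restrict (cminus c) (minusBase P)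
    Lan⊥≅restrict = ≅-trans (Lan-cplus⊥≅ c (plusBase P))
                            (restrict-resp-≅ (cminus c) (plus⊥≅minus P))
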